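{- Let $r$ be a positive integer, let $d$ be a degree sequence of length $n$, and let $(a,b)\in\mathrm{BP}(d)$ with $a=(a_1,\dots,a_p)$ and $b=(b_1,\dots,b_q)$ non-increasing. If $a_1\cdot b_1\le r\cdot \sum d/2 + r$, then $(a,b)$ is $r$-max-bigraphic.
   Context: A degree sequence is a non-increasing sequence of positive integers with even sum. $\mathrm{BP}(d)$ is the set of pairs $(a,b)$ of complementary subsequences of $d$ with equal sums. Multigraphs are loopless (parallel edges allowed). $(a,b)$ is $r$-max-bigraphic if there is a loopless multigraph with underlying bipartite graph with sides $A,B$, where the degree sequence of $A$ is $a$, that of $B$ is $b$, and every pair of vertices is joined by at most $r$ parallel edges. -}

module Defs where

open import Data.Nat using (ℕ; zero; suc; _+_; _*_; _≤_; _≥_)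
open import Data.Nat.Divisibility using (_∣_)
open import Data.Bool using (Bool; true; false)
open import Data.List using (List; []; _∷_; length; lookup)
open import Data.Nat.ListAction using (sum)
open import Data.List.Relation.Unary.All using (All)
open import Data.List.Relation.Unary.Linked using (Linked)
open import Data.Fin using (Fin)
open import Data.Product using (Σ; _×_; _,_; proj₁; proj₂)
open import Relation.Binary.PropositionalEquality using (_≡_)

∑ : (n : ℕ) → (Fin n → ℕ) → ℕ
∑ zero    f = 0
∑ (suc n) f = f Fin.zero + ∑ n (λ i → f (Fin.suc i))

record DegreeSequence (d : List ℕ) : Set where
  field
    nonIncreasing : Linked _≥_ d
    positive      : All (λ x → 1 ≤ x) d
    evenSum       : 2 ∣ sum d

split : List Bool → List ℕ → List ℕ × List ℕ
split []          _        = [] , []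
split (_ ∷ _)     []       = [] , []
split (true  ∷ m) (x ∷ d)  = let r = split m d in (x ∷ proj₁ r) , proj₂ r
split (false ∷ m) (x ∷ d)  = let r = split m d in proj₁ r , (x ∷ proj₂ r)

-- (a , b) ∈ BP(d): a and b are complementary subsequences of d with equal sums.
BP : List ℕ → List ℕ → List ℕ → Set
BP d a b = Σ (List Bool) λ mask →
             (length mask ≡ length d) × (split mask d ≡ (a , b)) × (sum a ≡ sum b)

-- first entry of a list (0 for the empty list; only relevant when d is empty)
head₀ : List ℕ → ℕ
head₀ []      = 0
head₀ (x ∷ _) = x

-- (a , b) is r-max-bigraphic: there is a loopless multigraph whose underlying graph is
-- bipartite with sides A = {1..p}, B = {1..q}, given by the edge multiplicities M i j
-- between the i-th vertex of A and j-th vertex of B, each at most r, such that the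
-- degree of the i-th vertex of A is a_i and that of the j-th vertex of B is b_j.
MaxBigraphic : ℕ → List ℕ → List ℕ → Set
MaxBigraphic r a b =
  Σ (Fin (length a) → Fin (length b) → ℕ) λ M →
    ((i : Fin (length a)) (j : Fin (length b)) → M i j ≤ r) ×
    ((i : Fin (length a)) → ∑ (length b) (M i) ≡ lookup a i) ×
    ((j : Fin (length b)) → ∑ (length a) (λ i → M i j) ≡ lookup b j)

{-# OPTIONS --safe #-}
-- The bound implies the capacitated Gale–Ryser condition: for non-increasing a, the inequalities
-- a₁ + … + a_k ≤ Σⱼ min (bⱼ , r k) for all k suffice for a realization with multiplicities at most r.
-- If b₁ ≤ r k the right-hand side is Σ b = Σ a. Otherwise c = r k < b₁; the bound times k gives
-- k a₁ b₁ ≤ c Σ b + c, and c bⱼ ≤ b₁ min (bⱼ , c) termwise turns this into k a₁ b₁ < b₁ (Σⱼ min (bⱼ , c) + 1),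
-- so a₁ + … + a_k ≤ k a₁ ≤ Σⱼ min (bⱼ , c).
-- Sufficiency is by induction on a: fill the first row one unit at a time, always into a column below
-- capacity of largest residual demand; the residual demands then satisfy the condition for the other rows.
module Submission where

open import Defs
open import Data.Nat using (ℕ; _*_; _+_; _≤_; _/_)
open import Data.List using (List)
open import Data.Nat.ListAction using (sum)

open import Data.Bool using (true; false)
open import Data.Fin using (Fin; zero; suc) renaming (_≟_ to _≟ᶠ_)
open import Data.Fin.Properties using (any?)
open import Data.List using ([]; _∷_; length; lookup; take; drop; filter; allFin)
open import Data.List.Extrema.Nat using (argmax; argmax-all; f[xs]≤f[argmax])
open import Data.List.Membership.Propositional.Properties using (∈-allFin; ∈-filter⁺; ∈-lookup)
open import Data.List.Properties using (take++drop≡id)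
open import Data.List.Relation.Binary.Sublist.Propositional using (_⊆_; []; _∷_; _∷ʳ_; minimum)
open import Data.List.Relation.Binary.Sublist.Propositional.Properties using (All-resp-⊆)
open import Data.List.Relation.Unary.All as All using (All; []; _∷_)
open import Data.List.Relation.Unary.All.Properties using (all-filter)
open import Data.List.Relation.Unary.AllPairs using (AllPairs; []; _∷_)
open import Data.List.Relation.Unary.Linked using (Linked)
open import Data.List.Relation.Unary.Linked.Properties using (Linked⇒AllPairs)
open import Data.Nat using (zero; suc; _∸_; _⊓_; _<_; _≥_; z≤n; s≤s⁻¹; _≤?_; _<?_)
open import Data.Nat.DivMod using (m*n/n≡m)
open import Data.Nat.ListAction.Properties using (sum-++)
open import Data.Nat.Properties
open import Algebra.Properties.CommutativeSemigroup +-commutativeSemigroup using (interchange; x∙yz≈y∙xz)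
open import Data.Nat.Tactic.RingSolver using (solve-∀)
open import Data.Product using (Σ; ∃-syntax; _×_; _,_; proj₁; proj₂)
open import Data.Vec.Functional using (updateAt)
open import Data.Vec.Functional.Properties using (updateAt-updates; updateAt-minimal)
open import Function using (_∘_; flip)
open import Relation.Binary.Core using (Rel)
open import Relation.Binary.PropositionalEquality
open import Relation.Nullary using (yes; no; contradiction)
open import Relation.Nullary.Decidable using (_×-dec_)
open import Relation.Unary using (Pred; Decidable)

∑-cong : ∀ n {f g : Fin n → ℕ} → (∀ i → f i ≡ g i) → ∑ n f ≡ ∑ n g
∑-cong zero    f≗g = refl
∑-cong (suc n) f≗g = cong₂ _+_ (f≗g zero) (∑-cong n (f≗g ∘ suc))

∑-mono-≤ : ∀ n {f g : Fin n → ℕ} → (∀ i → f i ≤ g i) → ∑ n f ≤ ∑ n g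
∑-mono-≤ zero    f≤g = z≤n
∑-mono-≤ (suc n) f≤g = +-mono-≤ (f≤g zero) (∑-mono-≤ n (f≤g ∘ suc))

∑-distrib-+ : ∀ n (f g : Fin n → ℕ) → ∑ n (λ i → f i + g i) ≡ ∑ n f + ∑ n g
∑-distrib-+ zero    f g = refl
∑-distrib-+ (suc n) f g =
  trans (cong (f zero + g zero +_) (∑-distrib-+ n (f ∘ suc) (g ∘ suc)))
        (interchange (f zero) (g zero) _ _)

*-distribˡ-∑ : ∀ n c (f : Fin n → ℕ) → c * ∑ n f ≡ ∑ n (λ i → c * f i)
*-distribˡ-∑ zero    c f = *-zeroʳ c
*-distribˡ-∑ (suc n) c f =
  trans (*-distribˡ-+ c (f zero) _) (cong (c * f zero +_) (*-distribˡ-∑ n c (f ∘ suc)))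

∑-zero : ∀ n → ∑ n (λ _ → 0) ≡ 0
∑-zero zero    = refl
∑-zero (suc n) = ∑-zero n

≤-∑ : ∀ n (f : Fin n → ℕ) i → f i ≤ ∑ n f
≤-∑ (suc n) f zero    = m≤m+n _ _
≤-∑ (suc n) f (suc i) = ≤-trans (≤-∑ n (f ∘ suc) i) (m≤n+m _ _)

∑-lookup : ∀ (l : List ℕ) → ∑ (length l) (lookup l) ≡ sum l
∑-lookup []      = refl
∑-lookup (x ∷ l) = cong (x +_) (∑-lookup l)

∑-<⇒∃< : ∀ n {f g : Fin n → ℕ} → ∑ n f < ∑ n g → ∃[ i ] f i < g i
∑-<⇒∃< n {f} {g} ∑f<∑g with any? (λ i → f i <? g i)
... | yes f<g = f<g
... | no  ∄f<g = contradiction (∑-mono-≤ n (λ i → ≮⇒≥ (λ fi<gi → ∄f<g (i , fi<gi)))) (<⇒≱ ∑f<∑g)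

∑-updateAt-suc : ∀ n (f : Fin n → ℕ) k → ∑ n (updateAt f k suc) ≡ suc (∑ n f)
∑-updateAt-suc (suc n) f zero    = refl
∑-updateAt-suc (suc n) f (suc k) = trans (cong (f zero +_) (∑-updateAt-suc n (f ∘ suc) k)) (+-suc _ _)

argmax-on : ∀ {n p} {P : Pred (Fin n) p} → Decidable P → (f : Fin n → ℕ) →
            ∀ {i₀} → P i₀ → ∃[ k ] P k × (∀ i → P i → f i ≤ f k)
argmax-on {n} {P = P} P? f {i₀} Pi₀ = k , argmax-all f Pi₀ (all-filter P? (allFin n)) , f≤f[k]
  where
  candidates : List (Fin n)
  candidates = filter P? (allFin n)
  k : Fin n
  k = argmax f i₀ candidates
  f≤f[k] : ∀ i → P i → f i ≤ f k
  f≤f[k] i Pi = All.lookup (f[xs]≤f[argmax] i₀ candidates) (∈-filter⁺ P? (∈-allFin i) Pi)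

m∸n≤1+m∸[1+n] : ∀ m n → m ∸ n ≤ suc (m ∸ suc n)
m∸n≤1+m∸[1+n] zero    zero    = z≤n
m∸n≤1+m∸[1+n] zero    (suc n) = z≤n
m∸n≤1+m∸[1+n] (suc m) zero    = ≤-refl
m∸n≤1+m∸[1+n] (suc m) (suc n) = m∸n≤1+m∸[1+n] m n

+-∸-⊓ : ∀ {x b c r} → x ≤ b → x ≤ r → (x < r → b ∸ x ≤ c) → x + (b ∸ x) ⊓ c ≡ b ⊓ (r + c)
+-∸-⊓ {x} {b} {c} {r} x≤b x≤r fits = begin
  x + (b ∸ x) ⊓ c          ≡⟨ +-distribˡ-⊓ x (b ∸ x) c ⟩
  (x + (b ∸ x)) ⊓ (x + c)  ≡⟨ cong (_⊓ (x + c)) (m+[n∸m]≡n x≤b) ⟩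
  b ⊓ (x + c)              ≡⟨ ⊓-raise ⟩
  b ⊓ (r + c)              ∎
  where
  open ≡-Reasoning
  ⊓-raise : b ⊓ (x + c) ≡ b ⊓ (r + c)
  ⊓-raise with x <? r
  ... | yes x<r = trans (m≤n⇒m⊓n≡m b≤x+c) (sym (m≤n⇒m⊓n≡m (≤-trans b≤x+c (+-monoˡ-≤ c x≤r))))
    where
    b≤x+c : b ≤ x + c
    b≤x+c = subst (_≤ x + c) (m+[n∸m]≡n x≤b) (+-monoʳ-≤ x (fits x<r))
  ... | no x≮r = cong (λ y → b ⊓ (y + c)) (≤-antisym x≤r (≮⇒≥ x≮r))

*-⊓-≤ : ∀ {c B v} → c ≤ B → v ≤ B → c * v ≤ B * (v ⊓ c)
*-⊓-≤ {c} {B} {v} c≤B v≤B with v ≤? c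
... | yes v≤c rewrite m≤n⇒m⊓n≡m v≤c = *-monoˡ-≤ v c≤B
... | no  v≰c rewrite m≥n⇒m⊓n≡n (<⇒≤ (≰⇒> v≰c)) = subst (_≤ B * c) (*-comm v c) (*-monoˡ-≤ c v≤B)

≤-∑-⊓ : ∀ n (v : Fin n → ℕ) {B c m} → c < B → (∀ j → v j ≤ B) → m * B ≤ c * ∑ n v + c →
        m ≤ ∑ n (λ j → v j ⊓ c)
≤-∑-⊓ n v {B} {c} {m} c<B v≤B bound = s≤s⁻¹ (*-cancelʳ-< B m (suc R) (begin-strict
  m * B          ≤⟨ bound ⟩
  c * ∑ n v + c  ≤⟨ +-monoˡ-≤ c c∑v≤BR ⟩
  B * R + c      <⟨ +-monoʳ-< (B * R) c<B ⟩
  B * R + B      ≡⟨ trans (+-comm (B * R) B) (cong (B +_) (*-comm B R)) ⟩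
  suc R * B      ∎))
  where
  open ≤-Reasoning
  R : ℕ
  R = ∑ n (λ j → v j ⊓ c)
  c∑v≤BR : c * ∑ n v ≤ B * R
  c∑v≤BR = begin
    c * ∑ n v                   ≡⟨ *-distribˡ-∑ n c v ⟩
    ∑ n (λ j → c * v j)         ≤⟨ ∑-mono-≤ n (λ j → *-⊓-≤ (<⇒≤ c<B) (v≤B j)) ⟩
    ∑ n (λ j → B * (v j ⊓ c))   ≡⟨ *-distribˡ-∑ n B (λ j → v j ⊓ c) ⟨
    B * R                       ∎

sum-take-≤-sum : ∀ k (l : List ℕ) → sum (take k l) ≤ sum l
sum-take-≤-sum k l = subst (sum (take k l) ≤_) sum≡ (m≤m+n _ _)
  where
  sum≡ : sum (take k l) + sum (drop k l) ≡ sum l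
  sum≡ = trans (sym (sum-++ (take k l) (drop k l))) (cong sum (take++drop≡id k l))

sum-take-≤-* : ∀ {A} k {l : List ℕ} → All (_≤ A) l → sum (take k l) ≤ k * A
sum-take-≤-* zero    _           = z≤n
sum-take-≤-* (suc k) []          = z≤n
sum-take-≤-* (suc k) (x≤A ∷ l≤A) = +-mono-≤ x≤A (sum-take-≤-* k l≤A)

sum-take-mono-∷ : ∀ k {x} {l : List ℕ} → AllPairs _≥_ (x ∷ l) → sum (take k l) ≤ sum (take k (x ∷ l))
sum-take-mono-∷ zero    _                                = z≤n
sum-take-mono-∷ (suc k) {l = []}    _                    = z≤n
sum-take-mono-∷ (suc k) {l = y ∷ l} ((x≥y ∷ _) ∷ y∷l↘) = +-mono-≤ x≥y (sum-take-mono-∷ k y∷l↘)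

head₀-max : ∀ {l : List ℕ} → AllPairs _≥_ l → All (_≤ head₀ l) l
head₀-max []        = []
head₀-max (x≥l ∷ _) = ≤-refl ∷ x≥l

lookup-≤-head₀ : ∀ {l : List ℕ} → AllPairs _≥_ l → ∀ i → lookup l i ≤ head₀ l
lookup-≤-head₀ l↘ i = All.lookup (head₀-max l↘) (∈-lookup i)

AllPairs-resp-⊇ : ∀ {a r} {A : Set a} {R : Rel A r} {xs ys : List A} → ys ⊆ xs → AllPairs R xs → AllPairs R ys
AllPairs-resp-⊇ []             []         = []
AllPairs-resp-⊇ (_ ∷ʳ ys⊆xs)   (_ ∷ xs↘)  = AllPairs-resp-⊇ ys⊆xs xs↘
AllPairs-resp-⊇ (refl ∷ ys⊆xs) (px ∷ xs↘) = All-resp-⊆ ys⊆xs px ∷ AllPairs-resp-⊇ ys⊆xs xs↘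

split-⊆ˡ : ∀ m (d : List ℕ) → proj₁ (split m d) ⊆ d
split-⊆ˡ []          d       = minimum d
split-⊆ˡ (_ ∷ _)     []      = []
split-⊆ˡ (true ∷ m)  (x ∷ d) = refl ∷ split-⊆ˡ m d
split-⊆ˡ (false ∷ m) (x ∷ d) = x ∷ʳ split-⊆ˡ m d

split-⊆ʳ : ∀ m (d : List ℕ) → proj₂ (split m d) ⊆ d
split-⊆ʳ []          d       = minimum d
split-⊆ʳ (_ ∷ _)     []      = []
split-⊆ʳ (true ∷ m)  (x ∷ d) = x ∷ʳ split-⊆ʳ m d
split-⊆ʳ (false ∷ m) (x ∷ d) = refl ∷ split-⊆ʳ m d

sum-split : ∀ m (d : List ℕ) → length m ≡ length d →
            sum (proj₁ (split m d)) + sum (proj₂ (split m d)) ≡ sum d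
sum-split []          []      _ = refl
sum-split (true ∷ m)  (x ∷ d) |m|≡|d| =
  trans (+-assoc x _ _) (cong (x +_) (sum-split m d (suc-injective |m|≡|d|)))
sum-split (false ∷ m) (x ∷ d) |m|≡|d| =
  trans (x∙yz≈y∙xz (sum (proj₁ (split m d))) x _) (cong (x +_) (sum-split m d (suc-injective |m|≡|d|)))

BP-sorted : ∀ {d a b} → Linked _≥_ d → BP d a b → AllPairs _≥_ a × AllPairs _≥_ b
BP-sorted {d} d↘ (m , _ , split≡ , _) =
  subst (AllPairs _≥_) (cong proj₁ split≡) (AllPairs-resp-⊇ (split-⊆ˡ m d) d↘′) ,
  subst (AllPairs _≥_) (cong proj₂ split≡) (AllPairs-resp-⊇ (split-⊆ʳ m d) d↘′)
  where
  d↘′ : AllPairs _≥_ d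
  d↘′ = Linked⇒AllPairs (flip ≤-trans) d↘

BP-half-sum : ∀ {d a b} → BP d a b → sum d / 2 ≡ sum b
BP-half-sum {d} {a} {b} (m , |m|≡|d| , split≡ , Σa≡Σb) = begin
  sum d / 2                 ≡⟨ cong (_/ 2) Σd≡Σb*2 ⟩
  sum b * 2 / 2             ≡⟨ m*n/n≡m (sum b) 2 ⟩
  sum b                     ∎
  where
  open ≡-Reasoning
  Σd≡Σb*2 : sum d ≡ sum b * 2
  Σd≡Σb*2 = begin
    sum d                                               ≡⟨ sum-split m d |m|≡|d| ⟨
    sum (proj₁ (split m d)) + sum (proj₂ (split m d))   ≡⟨ cong (λ ab → sum (proj₁ ab) + sum (proj₂ ab)) split≡ ⟩
    sum a + sum b                                       ≡⟨ cong (_+ sum b) Σa≡Σb ⟩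
    sum b + sum b                                       ≡⟨ cong (sum b +_) (*-identityʳ (sum b)) ⟨
    sum b + sum b * 1                                   ≡⟨ *-suc (sum b) 1 ⟨
    sum b * 2                                           ∎

module _ (r : ℕ) where

  GaleRyser : List ℕ → ∀ {q} → (Fin q → ℕ) → Set
  GaleRyser a {q} b = ∀ k → sum (take k a) ≤ ∑ q (λ j → b j ⊓ (r * k))

  -- MaxBigraphic r a b is Realization a (lookup b); the column degrees form a function so that the
  -- induction can replace them by residual demands.
  Realization : List ℕ → ∀ {q} → (Fin q → ℕ) → Set
  Realization a {q} b = Σ (Fin (length a) → Fin q → ℕ) λ M →
    (∀ i j → M i j ≤ r) ×
    (∀ i → ∑ q (M i) ≡ lookup a i) ×
    (∀ j → ∑ (length a) (λ i → M i j) ≡ b j)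

  record BalancedRow {q} (b : Fin q → ℕ) (n : ℕ) : Set where
    field
      row      : Fin q → ℕ
      ≤-cap    : ∀ j → row j ≤ r
      ≤-demand : ∀ j → row j ≤ b j
      total    : ∑ q row ≡ n
      balanced : ∀ j j′ → row j < r → 0 < row j′ → b j ∸ row j ≤ suc (b j′ ∸ row j′)

  module _ {q} {b : Fin q → ℕ} {n} (R : BalancedRow b n) where
    open BalancedRow R

    residual : Fin q → ℕ
    residual j = b j ∸ row j

    addUnit : ∀ k → row k < r → row k < b k → (∀ j → row j < r → residual j ≤ residual k) →
              BalancedRow b (suc n)
    addUnit k k-open k-unmet k-max = record
      { row      = row′
      ; ≤-cap    = ≤-cap′
      ; ≤-demand = ≤-demand′
      ; total    = trans (∑-updateAt-suc q row k) (cong suc total)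
      ; balanced = balanced′
      }
      where
      row′ : Fin q → ℕ
      row′ = updateAt row k suc
      ≤-cap′ : ∀ j → row′ j ≤ r
      ≤-cap′ j with j ≟ᶠ k
      ... | yes refl rewrite updateAt-updates k {suc} row = k-open
      ... | no  j≢k  rewrite updateAt-minimal j k {suc} row j≢k = ≤-cap j
      ≤-demand′ : ∀ j → row′ j ≤ b j
      ≤-demand′ j with j ≟ᶠ k
      ... | yes refl rewrite updateAt-updates k {suc} row = k-unmet
      ... | no  j≢k  rewrite updateAt-minimal j k {suc} row j≢k = ≤-demand j
      balanced′ : ∀ j j′ → row′ j < r → 0 < row′ j′ → b j ∸ row′ j ≤ suc (b j′ ∸ row′ j′)
      balanced′ j j′ j-open j′-used with j ≟ᶠ k | j′ ≟ᶠ k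
      ... | yes refl | yes refl rewrite updateAt-updates k {suc} row = n≤1+n _
      ... | no j≢k | yes refl
        rewrite updateAt-minimal j k {suc} row j≢k | updateAt-updates k {suc} row =
        ≤-trans (k-max j j-open) (m∸n≤1+m∸[1+n] (b k) (row k))
      ... | yes refl | no j′≢k
        rewrite updateAt-updates k {suc} row | updateAt-minimal j′ k {suc} row j′≢k =
        ≤-trans (∸-monoʳ-≤ (b k) (n≤1+n (row k))) (balanced k j′ k-open j′-used)
      ... | no j≢k | no j′≢k
        rewrite updateAt-minimal j k {suc} row j≢k | updateAt-minimal j′ k {suc} row j′≢k =
        balanced j j′ j-open j′-used

    residual-sum : n + ∑ q residual ≡ ∑ q b
    residual-sum = begin
      n + ∑ q residual                ≡⟨ cong (_+ ∑ q residual) total ⟨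
      ∑ q row + ∑ q residual          ≡⟨ ∑-distrib-+ q row residual ⟨
      ∑ q (λ j → row j + residual j)  ≡⟨ ∑-cong q (λ j → m+[n∸m]≡n (≤-demand j)) ⟩
      ∑ q b                           ∎
      where open ≡-Reasoning

    saturated : ∀ k {j₀} → row j₀ < r → r * k < residual j₀ →
                ∑ q (λ j → b j ⊓ (r * k)) ≤ ∑ q (λ j → residual j ⊓ (r * k))
    saturated k {j₀} j₀-open j₀-over = ∑-mono-≤ q capped
      where
      capped : ∀ j → b j ⊓ (r * k) ≤ residual j ⊓ (r * k)
      capped j with 0 <? row j
      ... | yes j-used = subst (b j ⊓ (r * k) ≤_) (sym (m≥n⇒m⊓n≡n rk≤res)) (m⊓n≤n _ _)
        where
        rk≤res : r * k ≤ residual j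
        rk≤res = s≤s⁻¹ (≤-trans j₀-over (balanced j₀ j j₀-open j-used))
      ... | no j-unused rewrite n≤0⇒n≡0 (≮⇒≥ j-unused) = ≤-refl

    unsaturated : ∀ k → (∀ j → row j < r → residual j ≤ r * k) →
                  n + ∑ q (λ j → residual j ⊓ (r * k)) ≡ ∑ q (λ j → b j ⊓ (r * suc k))
    unsaturated k fits = begin
      n + ∑ q (λ j → residual j ⊓ (r * k))            ≡⟨ cong (_+ ∑ q (λ j → residual j ⊓ (r * k))) total ⟨
      ∑ q row + ∑ q (λ j → residual j ⊓ (r * k))      ≡⟨ ∑-distrib-+ q row _ ⟨
      ∑ q (λ j → row j + residual j ⊓ (r * k))        ≡⟨ ∑-cong q capped ⟩
      ∑ q (λ j → b j ⊓ (r * suc k))                   ∎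
      where
      open ≡-Reasoning
      capped : ∀ j → row j + residual j ⊓ (r * k) ≡ b j ⊓ (r * suc k)
      capped j = trans (+-∸-⊓ (≤-demand j) (≤-cap j) (fits j)) (cong (b j ⊓_) (sym (*-suc r k)))

  balancedRow : ∀ {q} (b : Fin q → ℕ) n → n ≤ ∑ q (λ j → b j ⊓ r) → BalancedRow b n
  balancedRow {q} b zero _ = record
    { row      = λ _ → 0
    ; ≤-cap    = λ _ → z≤n
    ; ≤-demand = λ _ → z≤n
    ; total    = ∑-zero q
    ; balanced = λ _ _ _ ()
    }
  balancedRow {q} b (suc n) n<∑ = addUnit R k k-open k-unmet k-max
    where
    R : BalancedRow b n
    R = balancedRow b n (<⇒≤ n<∑)
    open BalancedRow R
    unfilled : ∃[ j ] row j < b j ⊓ r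
    unfilled = ∑-<⇒∃< q (subst (_< ∑ q (λ j → b j ⊓ r)) (sym total) n<∑)
    j₀ : Fin q
    j₀ = proj₁ unfilled
    j₀-open : row j₀ < r
    j₀-open = <-≤-trans (proj₂ unfilled) (m⊓n≤n _ _)
    j₀-unmet : row j₀ < b j₀
    j₀-unmet = <-≤-trans (proj₂ unfilled) (m⊓n≤m _ _)
    fullest : ∃[ k ] row k < r × (∀ j → row j < r → residual R j ≤ residual R k)
    fullest = argmax-on (λ j → row j <? r) (residual R) j₀-open
    k : Fin q
    k = proj₁ fullest
    k-open : row k < r
    k-open = proj₁ (proj₂ fullest)
    k-max : ∀ j → row j < r → residual R j ≤ residual R k
    k-max = proj₂ (proj₂ fullest)
    k-unmet : row k < b k
    k-unmet = m∸n≢0⇒n<m (m<n⇒n≢0 (<-≤-trans (m<n⇒0<n∸m j₀-unmet) (k-max j₀ j₀-open)))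

  -- If a column below capacity keeps residual demand above r k, balance keeps every used column at
  -- r k or more, so the k-th inequality survives removing the first row; otherwise the (k+1)-st
  -- inequality for b is a₁ plus the k-th one for the residual demands.
  GaleRyser-residual : ∀ {a₁ a q} {b : Fin q → ℕ} → AllPairs _≥_ (a₁ ∷ a) → (R : BalancedRow b a₁) →
                       GaleRyser (a₁ ∷ a) b → GaleRyser a (residual R)
  GaleRyser-residual {a₁} {a} {q} {b} a↘ R gr k
    with any? (λ j → (BalancedRow.row R j <? r) ×-dec (r * k <? residual R j))
  ... | yes (j₀ , j₀-open , j₀-over) = begin
    sum (take k a)                      ≤⟨ sum-take-mono-∷ k a↘ ⟩
    sum (take k (a₁ ∷ a))               ≤⟨ gr k ⟩
    ∑ q (λ j → b j ⊓ (r * k))           ≤⟨ saturated R k j₀-open j₀-over ⟩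
    ∑ q (λ j → residual R j ⊓ (r * k))  ∎
    where open ≤-Reasoning
  ... | no ∄over = +-cancelˡ-≤ a₁ _ _ (begin
    a₁ + sum (take k a)                      ≤⟨ gr (suc k) ⟩
    ∑ q (λ j → b j ⊓ (r * suc k))            ≡⟨ unsaturated R k fits ⟨
    a₁ + ∑ q (λ j → residual R j ⊓ (r * k))  ∎)
    where
    open ≤-Reasoning
    fits : ∀ j → BalancedRow.row R j < r → residual R j ≤ r * k
    fits j j-open = ≮⇒≥ (λ j-over → ∄over (j , j-open , j-over))

  Realization-∷ : ∀ {a₁ a q} {b : Fin q → ℕ} (R : BalancedRow b a₁) →
                  Realization a (residual R) → Realization (a₁ ∷ a) b
  Realization-∷ {a₁} {a} {q} {b} R (M , M≤r , rows , cols) = M′ , M′≤r , rows′ , cols′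
    where
    open BalancedRow R
    M′ : Fin (suc (length a)) → Fin q → ℕ
    M′ zero    = row
    M′ (suc i) = M i
    M′≤r : ∀ i j → M′ i j ≤ r
    M′≤r zero    = ≤-cap
    M′≤r (suc i) = M≤r i
    rows′ : ∀ i → ∑ q (M′ i) ≡ lookup (a₁ ∷ a) i
    rows′ zero    = total
    rows′ (suc i) = rows i
    cols′ : ∀ j → row j + ∑ (length a) (λ i → M i j) ≡ b j
    cols′ j = trans (cong (row j +_) (cols j)) (m+[n∸m]≡n (≤-demand j))

  realize : ∀ {a q} (b : Fin q → ℕ) → AllPairs _≥_ a → sum a ≡ ∑ q b → GaleRyser a b → Realization a b
  realize {[]} {q} b _ 0≡∑b _ =
    (λ ()) , (λ ()) , (λ ()) , λ j → sym (n≤0⇒n≡0 (subst (b j ≤_) (sym 0≡∑b) (≤-∑ q b j)))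
  realize {a₁ ∷ a} {q} b a↘@(_ ∷ a′↘) Σa≡∑b gr =
    Realization-∷ R (realize (residual R) a′↘ Σa′≡∑res (GaleRyser-residual a↘ R gr))
    where
    first-fits : a₁ ≤ ∑ q (λ j → b j ⊓ r)
    first-fits = subst₂ _≤_ (+-identityʳ a₁) (∑-cong q (λ j → cong (b j ⊓_) (*-identityʳ r))) (gr 1)
    R : BalancedRow b a₁
    R = balancedRow b a₁ first-fits
    Σa′≡∑res : sum a ≡ ∑ q (residual R)
    Σa′≡∑res = +-cancelˡ-≡ a₁ _ _ (trans Σa≡∑b (sym (residual-sum R)))

  GaleRyser-of-bound : ∀ {a b : List ℕ} → AllPairs _≥_ a → AllPairs _≥_ b → sum a ≡ sum b →
                       head₀ a * head₀ b ≤ r * sum b + r → GaleRyser a (lookup b)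
  GaleRyser-of-bound {a} {b} a↘ b↘ Σa≡Σb bound k with head₀ b ≤? r * k
  ... | yes b₁≤rk = begin
    sum (take k a)                              ≤⟨ sum-take-≤-sum k a ⟩
    sum a                                       ≡⟨ Σa≡Σb ⟩
    sum b                                       ≡⟨ ∑-lookup b ⟨
    ∑ (length b) (lookup b)                     ≡⟨ ∑-cong (length b) uncapped ⟨
    ∑ (length b) (λ j → lookup b j ⊓ (r * k))   ∎
    where
    open ≤-Reasoning
    uncapped : ∀ j → lookup b j ⊓ (r * k) ≡ lookup b j
    uncapped j = m≤n⇒m⊓n≡m (≤-trans (lookup-≤-head₀ b↘ j) b₁≤rk)
  ... | no b₁≰rk = begin
    sum (take k a)                              ≤⟨ sum-take-≤-* k (head₀-max a↘) ⟩
    k * head₀ a                                 ≤⟨ ≤-∑-⊓ (length b) (lookup b) (≰⇒> b₁≰rk) (lookup-≤-head₀ b↘) scaled ⟩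
    ∑ (length b) (λ j → lookup b j ⊓ (r * k))   ∎
    where
    open ≤-Reasoning
    k*[r*s+r]≡r*k*s+r*k : ∀ k r s → k * (r * s + r) ≡ r * k * s + r * k
    k*[r*s+r]≡r*k*s+r*k = solve-∀
    scaled : k * head₀ a * head₀ b ≤ r * k * ∑ (length b) (lookup b) + r * k
    scaled = begin
      k * head₀ a * head₀ b                  ≡⟨ *-assoc k (head₀ a) (head₀ b) ⟩
      k * (head₀ a * head₀ b)                ≤⟨ *-monoʳ-≤ k bound ⟩
      k * (r * sum b + r)                    ≡⟨ k*[r*s+r]≡r*k*s+r*k k r (sum b) ⟩
      r * k * sum b + r * k                  ≡⟨ cong (λ s → r * k * s + r * k) (∑-lookup b) ⟨
      r * k * ∑ (length b) (lookup b) + r * k ∎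

lemma36 : (r : ℕ) → 1 ≤ r → (d : List ℕ) → DegreeSequence d →
    (a b : List ℕ) → BP d a b →
    head₀ a * head₀ b ≤ r * (sum d / 2) + r →
    MaxBigraphic r a b
lemma36 r _ d ds a b bp@(_ , _ , _ , Σa≡Σb) bound =
  realize r (lookup b) a↘ (trans Σa≡Σb (sym (∑-lookup b))) (GaleRyser-of-bound r a↘ b↘ Σa≡Σb bound′)
  where
  sorted : AllPairs _≥_ a × AllPairs _≥_ b
  sorted = BP-sorted (DegreeSequence.nonIncreasing ds) bp
  a↘ : AllPairs _≥_ a
  a↘ = proj₁ sorted
  b↘ : AllPairs _≥_ b
  b↘ = proj₂ sorted
  bound′ : head₀ a * head₀ b ≤ r * sum b + r
  bound′ = subst (λ s → head₀ a * head₀ b ≤ r * s + r) (BP-half-sum bp) bound
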